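{- Let $S$ be a sorting sequence of length $p$ with $r>1$ distinct values and let $k\ge2$. The sorting strategy with outcome $S$ and $k$ coins in each pile discreetly proves that there are $f$ fake coins if and only if there exist a general solution for $S$ with $f-p$ fake coins satisfying the height bound for $k-1$ and a general solution for $S$ with $f$ fake coins satisfying the height bound for $k-1$ (i.e. configurations with $f-p$ and with $f$ fake coins when each pile has $k-1$ coins).
   Context: There are $pk$ labelled coins in $p$ piles of $k$ coins; each coin is real or fake, fake coins lighter (equal weights within each type). A sorting sequence of length $p$ is a non-decreasing sequence of $p$ non-negative integers beginning with $0$ in which each entry equals the previous one or exceeds it by $1$; it records the outcome of sorting the piles by weight (heaviest first; equal piles equal entries, a strictly lighter pile an entry one larger). If the distinct entries are $0,\dots,r-1$, let $p_i\ge1$ be the number of entries equal to $i-1$. A general solution with $f$ fake coins is an integer tuple $(f_1,\dots,f_r)$ with $0\le f_1<\dots<f_r$ and $\sum_ip_if_i=f$ ($f_i$ fake coins in each pile marked $i-1$); it satisfies the height bound for $k$ if $f_r\le k$. The strategy discreetly proves that there are $f$ fake coins if for every coin there is a configuration consistent with the outcome (each pile of size $k$) with exactly $f$ fake coins in which that coin is fake and one in which it is real. -}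

module Defs where

open import Data.Nat using (ℕ; zero; suc; _+_; _*_; _<_; _≤_)
open import Data.Nat.Properties using (_≟_)
open import Data.Bool using (Bool; true; false; if_then_else_)
open import Data.Fin using (Fin; toℕ) renaming (_<_ to _<ᶠ_)
open import Data.List using (List; map; allFin)
open import Data.Nat.ListAction using (sum)
open import Data.Product using (Σ; _×_; ∃)
open import Data.Sum using (_⊎_)
open import Relation.Nullary.Decidable using (⌊_⌋)
open import Relation.Binary.PropositionalEquality using (_≡_)

ΣFin : (n : ℕ) → (Fin n → ℕ) → ℕ
ΣFin n g = sum (map g (allFin n))

IsSortingSequence : {p : ℕ} → (Fin p → ℕ) → Set
IsSortingSequence {p} S =
  (0 < p)
  × (∀ (i : Fin p) → toℕ i ≡ 0 → S i ≡ 0)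
  × (∀ (i j : Fin p) → suc (toℕ i) ≡ toℕ j → (S j ≡ S i) ⊎ (S j ≡ suc (S i)))

DistinctValues : {p : ℕ} → (Fin p → ℕ) → ℕ → Set
DistinctValues {p} S r =
  (∀ (i : Fin p) → S i < r) × (∀ v → v < r → ∃ λ (i : Fin p) → S i ≡ v)

-- number of entries of S equal to v  (p_{v+1} in the paper)
mult : {p : ℕ} → (Fin p → ℕ) → ℕ → ℕ
mult {p} S v = ΣFin p (λ i → if ⌊ S i ≟ v ⌋ then 1 else 0)

-- A general solution (f_1,…,f_r) (stored as F : Fin r → ℕ, F i = f_{i+1})
-- for S with f fake coins satisfying the height bound for h.
GeneralSolution : {p : ℕ} → (Fin p → ℕ) → (r h f : ℕ) → Set
GeneralSolution S r h f =
  Σ (Fin r → ℕ) λ F →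
      (∀ (i j : Fin r) → i <ᶠ j → F i < F j)
    × (ΣFin r (λ i → mult S (toℕ i) * F i) ≡ f)
    × (∀ (i : Fin r) → F i ≤ h)

-- A configuration: coin t of pile j is fake iff c j t ≡ true.
Config : ℕ → ℕ → Set
Config p k = Fin p → Fin k → Bool

fakesIn : {p k : ℕ} → Config p k → Fin p → ℕ
fakesIn {p} {k} c j = ΣFin k (λ t → if c j t then 1 else 0)

totalFakes : {p k : ℕ} → Config p k → ℕ
totalFakes {p} c = ΣFin p (fakesIn c)

-- Consistent with outcome S (pile j received entry S j): equal entries
-- mean equal weight (equal number of fakes), a larger entry means
-- a strictly lighter pile (strictly more fakes).
Consistent : {p k : ℕ} → (Fin p → ℕ) → Config p k → Set
Consistent {p} S c =
  ∀ (i j : Fin p) →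
    (S i ≡ S j → fakesIn c i ≡ fakesIn c j)
    × (S i < S j → fakesIn c i < fakesIn c j)

DiscreetlyProves : {p : ℕ} → (Fin p → ℕ) → (k f : ℕ) → Set
DiscreetlyProves {p} S k f =
  ∀ (j : Fin p) (t : Fin k) →
      (∃ λ (c : Config p k) → Consistent S c × totalFakes c ≡ f × c j t ≡ true)
    × (∃ λ (c : Config p k) → Consistent S c × totalFakes c ≡ f × c j t ≡ false)

module Submission where

-- A configuration is consistent with S exactly when pile j holds f_{S j + 1} fakes for some
-- strictly increasing (f_1, …, f_r) bounded by k, and its total is then ∑ p_i f_i. Within one pile of k
-- coins, a prescribed coin can be made fake whenever the pile has 1 ≤ m ≤ k fakes and real
-- whenever m ≤ k − 1: swap it with a coin of the pattern "the first m coins are fake".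
-- A fake coin in a heaviest pile forces f_1 ≥ 1, hence every f_i ≥ 1, and lowering all f_i by one
-- gives a solution with f − p fakes and height k − 1; a real coin in a lightest pile forces
-- f_r ≤ k − 1. Conversely these two solutions make any chosen coin fake, respectively real.

open import Defs
open import Data.Nat using (ℕ; _+_; _∸_; _<_; _≤_)
open import Data.Fin using (Fin)
open import Data.Product using (_×_; ∃)
open import Function.Bundles using (_⇔_)
open import Relation.Binary.PropositionalEquality using (_≡_)

open import Data.Bool using (Bool; true; false; if_then_else_)
open import Data.Fin using (zero; suc; toℕ; fromℕ; fromℕ<; punchIn)
  renaming (_<_ to _<ᶠ_; _≤_ to _≤ᶠ_; _≟_ to _≟ᶠ_)
open import Data.Fin.Properties using (toℕ-injective; toℕ<n; toℕ-fromℕ<; ≤fromℕ; punchInᵢ≢i)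
import Data.Fin.Permutation as Perm
import Data.Fin.Permutation.Components as PC
open import Data.List using (tabulate)
open import Data.List.Properties using (map-tabulate)
import Data.Nat.ListAction as List
open import Data.Nat using (_*_; zero; suc; pred; _<ᵇ_; z≤n; s≤s; z<s; s≤s⁻¹; s<s⁻¹; >-nonZero)
open import Data.Nat.Properties
open import Algebra.Properties.Semiring.Sum +-*-semiring
  using (sum; sum-cong-≗; sum-remove; sum-permute; sum-replicate-zero; ∑-comm; ∑-distrib-+;
         *-distribʳ-sum)
open import Data.Product using (Σ; _,_; proj₁; proj₂)
open import Data.Sum using (inj₁; inj₂)
open import Function using (_∘_; id; mk⇔)
open import Relation.Nullary.Decidable using (⌊_⌋; yes; no)
open import Relation.Nullary.Negation using (contradiction)
open import Relation.Binary.PropositionalEquality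
  using (_≢_; refl; sym; trans; cong; cong₂; subst; subst₂; module ≡-Reasoning)

sum-tabulate : ∀ {n} (g : Fin n → ℕ) → List.sum (tabulate g) ≡ sum g
sum-tabulate {zero} g = refl
sum-tabulate {suc n} g = cong (g zero +_) (sum-tabulate (g ∘ suc))

ΣFin≡sum : ∀ n (g : Fin n → ℕ) → ΣFin n g ≡ sum g
ΣFin≡sum n g = trans (cong List.sum (map-tabulate id g)) (sum-tabulate g)

sum-ones : ∀ n → sum {n} (λ _ → 1) ≡ n
sum-ones zero = refl
sum-ones (suc n) = cong suc (sum-ones n)

indicator : ℕ → ℕ → ℕ
indicator a b = if ⌊ a ≟ b ⌋ then 1 else 0

indicator-diag : ∀ a → indicator a a ≡ 1
indicator-diag a with a ≟ a
... | yes _   = refl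
... | no a≢a = contradiction refl a≢a

indicator-off : ∀ {a b} → a ≢ b → indicator a b ≡ 0
indicator-off {a} {b} a≢b with a ≟ b
... | yes a≡b = contradiction a≡b a≢b
... | no _    = refl

sum-indicator : ∀ {r} (H : Fin r → ℕ) (w : Fin r) →
  sum (λ v → indicator (toℕ w) (toℕ v) * H v) ≡ H w
sum-indicator {suc r} H w = begin
  sum (λ v → indicator (toℕ w) (toℕ v) * H v)
    ≡⟨ sum-remove {i = w} (λ v → indicator (toℕ w) (toℕ v) * H v) ⟩
  indicator (toℕ w) (toℕ w) * H w
    + sum (λ i → indicator (toℕ w) (toℕ (punchIn w i)) * H (punchIn w i))
    ≡⟨ cong₂ _+_ (cong (_* H w) (indicator-diag (toℕ w))) (sum-cong-≗ vanish) ⟩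
  1 * H w + sum {r} (λ _ → 0)
    ≡⟨ cong₂ _+_ (*-identityˡ (H w)) (sum-replicate-zero r) ⟩
  H w + 0
    ≡⟨ +-identityʳ (H w) ⟩
  H w ∎
  where
  open ≡-Reasoning
  vanish : ∀ i → indicator (toℕ w) (toℕ (punchIn w i)) * H (punchIn w i) ≡ 0
  vanish i = cong (_* H (punchIn w i))
    (indicator-off (punchInᵢ≢i w i ∘ toℕ-injective ∘ sym))

count : ∀ {k} → (Fin k → Bool) → ℕ
count b = sum (λ u → if b u then 1 else 0)

fakesIn≡count : ∀ {p k} (c : Config p k) j → fakesIn c j ≡ count (c j)
fakesIn≡count {k = k} c j = ΣFin≡sum k _

count≤ : ∀ {k} (b : Fin k → Bool) → count b ≤ k
count≤ {zero} b = z≤n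
count≤ {suc k} b with b zero
... | true  = s≤s (count≤ (b ∘ suc))
... | false = m≤n⇒m≤1+n (count≤ (b ∘ suc))

count-true : ∀ {k} (b : Fin k → Bool) t → b t ≡ true → 0 < count b
count-true b zero b₀≡true rewrite b₀≡true = z<s
count-true b (suc t) bt≡true = <-≤-trans (count-true (b ∘ suc) t bt≡true) (m≤n+m _ _)

count-false : ∀ {k} (b : Fin k → Bool) t → b t ≡ false → count b < k
count-false b zero b₀≡false rewrite b₀≡false = s≤s (count≤ (b ∘ suc))
count-false b (suc t) bt≡false with b zero
... | true  = s≤s (count-false (b ∘ suc) t bt≡false)
... | false = m<n⇒m<1+n (count-false (b ∘ suc) t bt≡false)

prefix : ∀ {k} → ℕ → Fin k → Bool
prefix m u = toℕ u <ᵇ m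

prefix-last : ∀ {h m} → m ≤ h → prefix m (fromℕ h) ≡ false
prefix-last {zero}  z≤n = refl
prefix-last {suc h} z≤n = refl
prefix-last {suc h} (s≤s m≤h) = prefix-last m≤h

count-prefix : ∀ {k m} → m ≤ k → count (prefix {k} m) ≡ m
count-prefix {zero}  z≤n = refl
count-prefix {suc k} {zero} _ = sum-replicate-zero k
count-prefix {suc k} {suc m} (s≤s m≤k) = cong suc (count-prefix m≤k)

count-transpose : ∀ {k} (b : Fin k → Bool) (s t : Fin k) →
  count (b ∘ PC.transpose s t) ≡ count b
count-transpose b s t = sym (sum-permute (λ u → if b u then 1 else 0) (Perm.transpose s t))

transpose-at : ∀ {k} (s t : Fin k) → PC.transpose s t s ≡ t
transpose-at s t with s ≟ᶠ s
... | yes _   = refl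
... | no s≢s = contradiction refl s≢s

swappedPrefix : ∀ {k m} → m ≤ k → (t s : Fin k) →
  Σ (Fin k → Bool) λ b → count b ≡ m × b t ≡ prefix m s
swappedPrefix {m = m} m≤k t s =
  prefix m ∘ PC.transpose t s ,
  trans (count-transpose (prefix m) t s) (count-prefix m≤k) ,
  cong (prefix m) (transpose-at t s)

StrictlyIncreasing : ∀ {n} → (Fin n → ℕ) → Set
StrictlyIncreasing {n} F = ∀ (i j : Fin n) → i <ᶠ j → F i < F j

increasing⇒monotone : ∀ {n} {F : Fin n → ℕ} → StrictlyIncreasing F →
  ∀ {i j} → i ≤ᶠ j → F i ≤ F j
increasing⇒monotone {F = F} inc {i} {j} i≤j with m≤n⇒m<n∨m≡n i≤j
... | inj₁ i<j = <⇒≤ (inc i j i<j)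
... | inj₂ i≡j = ≤-reflexive (cong F (toℕ-injective i≡j))

≥first : ∀ {n} {F : Fin (suc n) → ℕ} → StrictlyIncreasing F → ∀ v → F zero ≤ F v
≥first inc v = increasing⇒monotone inc z≤n

≤last : ∀ {n} {F : Fin (suc n) → ℕ} → StrictlyIncreasing F → ∀ v → F v ≤ F (fromℕ n)
≤last inc v = increasing⇒monotone inc (≤fromℕ v)

Realizable : ∀ {p} → (Fin p → ℕ) → (k f : ℕ) → Fin p → Fin k → Bool → Set
Realizable {p} S k f j t b =
  ∃ λ (c : Config p k) → Consistent S c × totalFakes c ≡ f × c j t ≡ b

module _ {p r : ℕ} {S : Fin p → ℕ} (dv : DistinctValues S r) where

  level : Fin p → Fin r
  level j = fromℕ< (proj₁ dv j)

  toℕ-level : ∀ j → toℕ (level j) ≡ S j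
  toℕ-level j = toℕ-fromℕ< (proj₁ dv j)

  level-injective : ∀ {i j} → S i ≡ S j → level i ≡ level j
  level-injective {i} {j} Si≡Sj = toℕ-injective (trans (toℕ-level i) (trans Si≡Sj (sym (toℕ-level j))))

  representative : Fin r → Fin p
  representative v = proj₁ (proj₂ dv (toℕ v) (toℕ<n v))

  S-representative : ∀ v → S (representative v) ≡ toℕ v
  S-representative v = proj₂ (proj₂ dv (toℕ v) (toℕ<n v))

  weight : (Fin r → ℕ) → ℕ
  weight F = ΣFin r (λ v → mult S (toℕ v) * F v)

  weight≡sum : ∀ F → weight F ≡ sum (F ∘ level)
  weight≡sum F = begin
    ΣFin r (λ v → mult S (toℕ v) * F v)
      ≡⟨ ΣFin≡sum r _ ⟩
    sum (λ v → mult S (toℕ v) * F v)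
      ≡⟨ sum-cong-≗ distribute ⟩
    sum (λ v → sum (λ j → indicator (S j) (toℕ v) * F v))
      ≡⟨ ∑-comm (λ v j → indicator (S j) (toℕ v) * F v) ⟩
    sum (λ j → sum (λ v → indicator (S j) (toℕ v) * F v))
      ≡⟨ sum-cong-≗ select ⟩
    sum (F ∘ level) ∎
    where
    open ≡-Reasoning
    distribute : ∀ v → mult S (toℕ v) * F v ≡ sum (λ j → indicator (S j) (toℕ v) * F v)
    distribute v = trans (cong (_* F v) (ΣFin≡sum p _))
                         (*-distribʳ-sum (F v) (λ j → indicator (S j) (toℕ v)))
    select : ∀ j → sum (λ v → indicator (S j) (toℕ v) * F v) ≡ F (level j)
    select j = subst (λ a → sum (λ v → indicator a (toℕ v) * F v) ≡ F (level j))
                     (toℕ-level j) (sum-indicator F (level j))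

  weight-suc : ∀ {F G} → (∀ v → F v ≡ suc (G v)) → weight F ≡ p + weight G
  weight-suc {F} {G} F≗sucG = begin
    weight F                                  ≡⟨ weight≡sum F ⟩
    sum (F ∘ level)                           ≡⟨ sum-cong-≗ (F≗sucG ∘ level) ⟩
    sum (λ j → 1 + G (level j))               ≡⟨ ∑-distrib-+ (λ _ → 1) (G ∘ level) ⟩
    sum {p} (λ _ → 1) + sum (G ∘ level)       ≡⟨ cong₂ _+_ (sum-ones p) (sym (weight≡sum G)) ⟩
    p + weight G                              ∎
    where open ≡-Reasoning

  consistent-from-increasing : ∀ {k F} → StrictlyIncreasing F → (c : Config p k) →
    (∀ j → fakesIn c j ≡ F (level j)) → Consistent S c × totalFakes c ≡ weight F
  consistent-from-increasing {k} {F} inc c counts = consistent , total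
    where
    consistent : Consistent S c
    consistent i j = same , lighter
      where
      same : S i ≡ S j → fakesIn c i ≡ fakesIn c j
      same Si≡Sj = begin
        fakesIn c i    ≡⟨ counts i ⟩
        F (level i)    ≡⟨ cong F (level-injective Si≡Sj) ⟩
        F (level j)    ≡⟨ sym (counts j) ⟩
        fakesIn c j    ∎
        where open ≡-Reasoning
      lighter : S i < S j → fakesIn c i < fakesIn c j
      lighter Si<Sj = subst₂ _<_ (sym (counts i)) (sym (counts j))
        (inc (level i) (level j) (subst₂ _<_ (sym (toℕ-level i)) (sym (toℕ-level j)) Si<Sj))
    total : totalFakes c ≡ weight F
    total = trans (ΣFin≡sum p (fakesIn c)) (trans (sum-cong-≗ counts) (sym (weight≡sum F)))

  pileCounts : ∀ {k} → Config p k → Fin r → ℕ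
  pileCounts c = fakesIn c ∘ representative

  module _ {k} (c : Config p k) (consistent : Consistent S c) where

    fakesIn≡pileCounts : ∀ j → fakesIn c j ≡ pileCounts c (level j)
    fakesIn≡pileCounts j = proj₁ (consistent j (representative (level j)))
      (sym (trans (S-representative (level j)) (toℕ-level j)))

    pileCounts-increasing : StrictlyIncreasing (pileCounts c)
    pileCounts-increasing v w v<w = proj₂ (consistent (representative v) (representative w))
      (subst₂ _<_ (sym (S-representative v)) (sym (S-representative w)) v<w)

    totalFakes≡weight : totalFakes c ≡ weight (pileCounts c)
    totalFakes≡weight =
      proj₂ (consistent-from-increasing pileCounts-increasing c fakesIn≡pileCounts)

  realize : ∀ {k F} → StrictlyIncreasing F → (∀ v → F v ≤ k) → (t s : Fin k) →
    ∃ λ (c : Config p k) →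
      Consistent S c × totalFakes c ≡ weight F × (∀ j → c j t ≡ prefix (F (level j)) s)
  realize {k} {F} inc F≤k t s =
    c , proj₁ realized , proj₂ realized , (proj₂ ∘ proj₂ ∘ pile)
    where
    pile : ∀ j → Σ (Fin k → Bool) λ b → count b ≡ F (level j) × b t ≡ prefix (F (level j)) s
    pile j = swappedPrefix (F≤k (level j)) t s
    c : Config p k
    c = proj₁ ∘ pile
    counts : ∀ j → fakesIn c j ≡ F (level j)
    counts j = trans (fakesIn≡count c j) (proj₁ (proj₂ (pile j)))
    realized : Consistent S c × totalFakes c ≡ weight F
    realized = consistent-from-increasing inc c counts

  fake-realizable : ∀ {h f} → (∃ λ g → g + p ≡ f × GeneralSolution S r h g) →
    ∀ j t → Realizable S (suc h) f j t true
  fake-realizable {h} {f} (g , g+p≡f , G , inc , weightG , G≤h) j t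
    with realize {F = suc ∘ G} (λ v w v<w → s≤s (inc v w v<w)) (s≤s ∘ G≤h) t zero
  ... | c , consistent , total , at = c , consistent , shifted-total , at j
    where
    open ≡-Reasoning
    shifted-total : totalFakes c ≡ f
    shifted-total = begin
      totalFakes c       ≡⟨ total ⟩
      weight (suc ∘ G)   ≡⟨ weight-suc (λ _ → refl) ⟩
      p + weight G       ≡⟨ cong (p +_) weightG ⟩
      p + g              ≡⟨ +-comm p g ⟩
      g + p              ≡⟨ g+p≡f ⟩
      f                  ∎

  real-realizable : ∀ {h f} → GeneralSolution S r h f →
    ∀ j t → Realizable S (suc h) f j t false
  real-realizable {h} (F , inc , weightF , F≤h) j t
    with realize inc (m≤n⇒m≤1+n ∘ F≤h) t (fromℕ h)
  ... | c , consistent , total , at =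
    c , consistent , trans total weightF , trans (at j) (prefix-last (F≤h (level j)))

  shift-down : ∀ {h F} → StrictlyIncreasing F → (∀ v → 0 < F v) → (∀ v → F v ≤ suc h) →
    ∃ λ g → g + p ≡ weight F × GeneralSolution S r h g
  shift-down {h} {F} inc F>0 F≤1+h =
    weight G , g+p , G , G-increasing , refl , G≤h
    where
    G : Fin r → ℕ
    G = pred ∘ F
    F≗sucG : ∀ v → F v ≡ suc (G v)
    F≗sucG v = sym (suc-pred (F v) ⦃ >-nonZero (F>0 v) ⦄)
    g+p : weight G + p ≡ weight F
    g+p = trans (+-comm (weight G) p) (sym (weight-suc F≗sucG))
    G-increasing : StrictlyIncreasing G
    G-increasing v w v<w = s<s⁻¹ (subst₂ _<_ (F≗sucG v) (F≗sucG w) (inc v w v<w))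
    G≤h : ∀ v → G v ≤ h
    G≤h v = s≤s⁻¹ (subst (_≤ suc h) (F≗sucG v) (F≤1+h v))

module _ {p r : ℕ} {S : Fin p → ℕ} (dv : DistinctValues S (suc r)) where

  heaviest lightest : Fin p
  heaviest = representative dv zero
  lightest = representative dv (fromℕ r)

  shifted-from-fake-in-heaviest : ∀ {h f t} → Realizable S (suc h) f heaviest t true →
    ∃ λ g → g + p ≡ f × GeneralSolution S (suc r) h g
  shifted-from-fake-in-heaviest {h} {f} {t} (c , consistent , total , fake)
    with shift-down dv (pileCounts-increasing dv c consistent) positive bounded
    where
    heaviest>0 : 0 < pileCounts dv c zero
    heaviest>0 = subst (0 <_) (sym (fakesIn≡count c heaviest)) (count-true (c heaviest) t fake)
    positive : ∀ v → 0 < pileCounts dv c v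
    positive v = <-≤-trans heaviest>0 (≥first (pileCounts-increasing dv c consistent) v)
    bounded : ∀ v → pileCounts dv c v ≤ suc h
    bounded v = subst (_≤ suc h) (sym (fakesIn≡count c (representative dv v)))
                      (count≤ (c (representative dv v)))
  ... | g , g+p , solution =
    g , trans g+p (trans (sym (totalFakes≡weight dv c consistent)) total) , solution

  solution-from-real-in-lightest : ∀ {h f t} → Realizable S (suc h) f lightest t false →
    GeneralSolution S (suc r) h f
  solution-from-real-in-lightest {h} {f} {t} (c , consistent , total , real) =
    pileCounts dv c , pileCounts-increasing dv c consistent ,
    trans (sym (totalFakes≡weight dv c consistent)) total , bounded
    where
    lightest<1+h : pileCounts dv c (fromℕ r) < suc h
    lightest<1+h = subst (_< suc h) (sym (fakesIn≡count c lightest))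
                         (count-false (c lightest) t real)
    bounded : ∀ v → pileCounts dv c v ≤ h
    bounded v =
      s≤s⁻¹ (≤-<-trans (≤last (pileCounts-increasing dv c consistent) v) lightest<1+h)

mainTheorem15 : (p r k f : ℕ) (S : Fin p → ℕ) →
    IsSortingSequence S → DistinctValues S r → 1 < r → 2 ≤ k →
    DiscreetlyProves S k f ⇔
    ((∃ λ g → g + p ≡ f × GeneralSolution S r (k ∸ 1) g)
    × GeneralSolution S r (k ∸ 1) f)
mainTheorem15 p (suc r) (suc h) f S _ dv _ _ = mk⇔
  (λ discreet → shifted-from-fake-in-heaviest dv (proj₁ (discreet _ zero))
              , solution-from-real-in-lightest dv (proj₂ (discreet _ zero)))
  (λ (shifted , solution) j t →
    fake-realizable dv shifted j t , real-realizable dv solution j t)
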